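{- For every $m\in\mathbb{N}$, as an identity of rational functions in indeterminates $x,y$, \[ \frac{(1-x^{m+1})(1-y^{m+1})}{(1-x)^{m+1}(1-y)^{m+1}}=\sum_{r=0}^{m}\sum_{s=0}^{m-r}\frac{m+1}{m+1-r-s}\binom{m-r}{s}\binom{m-s}{r}\frac{x^ry^s}{(1-x)^{r+s}(1-y)^{r+s}}. \]
   Context: $\mathbb{N}$ denotes the positive integers. -}

module Defs where

open import Data.Nat using (ℕ; zero; suc)
open import Data.Rational using (ℚ; 0ℚ; 1ℚ; _+_; _*_)

infixr 8 _^ℚ_
_^ℚ_ : ℚ → ℕ → ℚ
q ^ℚ zero = 1ℚ
q ^ℚ suc n = q * (q ^ℚ n)

sumTo : ℕ → (ℕ → ℚ) → ℚ
sumTo zero f = f zero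
sumTo (suc n) f = sumTo n f + f (suc n)

{-# OPTIONS --safe #-}

-- Write N = m + 1, u = 1 / ((1 - x) (1 - y)), P = x u and Q = y u. The left-hand side is
-- E^N + F^N - P^N - Q^N with E = u and F = x y u, and since E + F = 1 + P + Q and E F = P Q the
-- power sums g_N = E^N + F^N are determined by g₀ = 2, g₁ = 1 + P + Q and
-- g_(N+2) + P Q g_N = (1 + P + Q) g_(N+1). This recurrence is solved by polynomials in P, Q whose
-- coefficient of P^r Q^s only depends on r, s and the excess K = N - r - s: for K = 0 it comes
-- from P^N + Q^N, and for K ≥ 1 it is the coefficient of P^r Q^s in
-- (1 - P Q) / ((1 - P) (1 - Q))^(K + 1), because multiplying by (1 - P) (1 - Q) lowers K by one.
-- The absorption identity (j + 1) C(j + 1 + r, r) = (r + 1) C(j + 1 + r, r + 1) turns that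
-- coefficient into (N / K) C(K - 1 + r, r) C(K - 1 + s, s).

module Submission where

open import Defs
open import Data.Nat using (ℕ; suc; _∸_)
open import Data.Nat.Combinatorics using (_C_)
open import Data.Integer using (+_)
open import Data.Rational using (ℚ; NonZero; 1ℚ; _+_; _*_; _-_; _/_; 1/_)
open import Relation.Binary.PropositionalEquality using (_≡_)

open import Algebra.Bundles using (CommutativeRing)
import Algebra.Properties.CommutativeSemiring.Exp as Exp
import Algebra.Properties.Group as GroupProperties
open import Data.Nat as ℕ using (zero; z≤n; s≤s; _≤_; _<_)
import Data.Nat.Properties as ℕ
open import Data.Nat.Combinatorics using (nCn≡1; nCk+nC[k+1]≡[n+1]C[k+1])
open import Data.Nat.Coprimality using (1-coprimeTo)
import Data.Nat.Coprimality as Coprime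
import Data.Integer as ℤ
import Data.Integer.Properties as ℤ
open import Data.Product using (_×_; _,_; proj₁)
open import Data.Rational using (mkℚ; 0ℚ)
open import Data.Rational.Properties
import Data.Rational.Unnormalised as ℚᵘ
import Data.Rational.Unnormalised.Properties as ℚᵘ
open import Function using (_∘_)
open import Relation.Binary.PropositionalEquality
  using (refl; sym; trans; cong; cong₂; subst; subst₂; module ≡-Reasoning)
open import Relation.Nullary.Decidable using (dec⇒maybe)
open import Tactic.RingSolver using (solve-∀)
open import Tactic.RingSolver.Core.AlmostCommutativeRing
  using (AlmostCommutativeRing; fromCommutativeRing)

open ≡-Reasoning
open GroupProperties +-0-group using (∙-cancelʳ)
open Exp (CommutativeRing.commutativeSemiring +-*-commutativeRing) using (_^_; ^-homo-*; ^-distrib-*)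

ℚ-ring : AlmostCommutativeRing _ _
ℚ-ring = fromCommutativeRing +-*-commutativeRing (λ x → dec⇒maybe (0ℚ ≟ x))

-- Built with mkℚ rather than as + n / 1 so that NonZero (fromℕ (suc k)) is found by instance search.
fromℕ : ℕ → ℚ
fromℕ n = mkℚ (+ n) 0 (Coprime.sym (1-coprimeTo n))

n/1≡fromℕ : ∀ n → + n / 1 ≡ fromℕ n
n/1≡fromℕ n = fromℚᵘ-toℚᵘ (fromℕ n)

fromℕ-+ : ∀ m n → fromℕ (m ℕ.+ n) ≡ fromℕ m + fromℕ n
fromℕ-+ m n =
  toℚᵘ-injective (ℚᵘ.≃-sym (ℚᵘ.≃-trans (toℚᵘ-homo-+ (fromℕ m) (fromℕ n)) (ℚᵘ.*≡* eq)))
  where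
  eq : (+ m ℤ.* + 1 ℤ.+ + n ℤ.* + 1) ℤ.* + 1 ≡ + (m ℕ.+ n) ℤ.* + 1
  eq = cong (ℤ._* + 1)
            (trans (cong₂ ℤ._+_ (ℤ.*-identityʳ (+ m)) (ℤ.*-identityʳ (+ n))) (sym (ℤ.pos-+ m n)))

n/[1+k]*[1+k]≡n : ∀ n k → (+ n / suc k) * fromℕ (suc k) ≡ fromℕ n
n/[1+k]*[1+k]≡n n k = toℚᵘ-injective
  (ℚᵘ.≃-trans (toℚᵘ-homo-* (+ n / suc k) (fromℕ (suc k)))
              (ℚᵘ.≃-trans (ℚᵘ.*-cong (toℚᵘ-fromℚᵘ (ℚᵘ.mkℚᵘ (+ n) k)) ℚᵘ.≃-refl) (ℚᵘ.*≡* eq)))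
  where
  eq : (+ n ℤ.* + suc k) ℤ.* + 1 ≡ + n ℤ.* + suc (k ℕ.* 1)
  eq = trans (ℤ.*-identityʳ _) (cong (λ d → + n ℤ.* + suc d) (sym (ℕ.*-identityʳ k)))

*-cancelʳ-≡ : ∀ p q r .{{_ : NonZero r}} → p * r ≡ q * r → p ≡ q
*-cancelʳ-≡ p q r pr≡qr = trans (sym (undo p)) (trans (cong (_* 1/ r) pr≡qr) (undo q))
  where
  undo : ∀ x → x * r * 1/ r ≡ x
  undo x = trans (*-assoc x r (1/ r)) (trans (cong (x *_) (*-inverseʳ r)) (*-identityʳ x))

^ℚ≡^ : ∀ x n → x ^ℚ n ≡ x ^ n
^ℚ≡^ x zero    = refl
^ℚ≡^ x (suc n) = cong (x *_) (^ℚ≡^ x n)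

^ℚ-distrib-* : ∀ x y n → (x * y) ^ℚ n ≡ x ^ℚ n * y ^ℚ n
^ℚ-distrib-* x y n = begin
  (x * y) ^ℚ n       ≡⟨ ^ℚ≡^ (x * y) n ⟩
  (x * y) ^ n        ≡⟨ ^-distrib-* x y n ⟩
  x ^ n * y ^ n      ≡⟨ cong₂ _*_ (^ℚ≡^ x n) (^ℚ≡^ y n) ⟨
  x ^ℚ n * y ^ℚ n    ∎

^ℚ-homo-* : ∀ x m n → x ^ℚ (m ℕ.+ n) ≡ x ^ℚ m * x ^ℚ n
^ℚ-homo-* x m n = begin
  x ^ℚ (m ℕ.+ n)     ≡⟨ ^ℚ≡^ x (m ℕ.+ n) ⟩
  x ^ (m ℕ.+ n)      ≡⟨ ^-homo-* x m n ⟩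
  x ^ m * x ^ n      ≡⟨ cong₂ _*_ (^ℚ≡^ x m) (^ℚ≡^ x n) ⟨
  x ^ℚ m * x ^ℚ n    ∎

sumTo-cong : ∀ n {f g : ℕ → ℚ} → (∀ {i} → i ≤ n → f i ≡ g i) → sumTo n f ≡ sumTo n g
sumTo-cong zero    f≡g = f≡g z≤n
sumTo-cong (suc n) f≡g = cong₂ _+_ (sumTo-cong n (f≡g ∘ ℕ.m≤n⇒m≤1+n)) (f≡g ℕ.≤-refl)

sumTo-0 : ∀ n {f : ℕ → ℚ} → (∀ {i} → i ≤ n → f i ≡ 0ℚ) → sumTo n f ≡ 0ℚ
sumTo-0 zero    f≡0 = f≡0 z≤n
sumTo-0 (suc n) f≡0 = cong₂ _+_ (sumTo-0 n (f≡0 ∘ ℕ.m≤n⇒m≤1+n)) (f≡0 ℕ.≤-refl)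

sumTo-last : ∀ n {f : ℕ → ℚ} → (∀ {i} → i < n → f i ≡ 0ℚ) → sumTo n f ≡ f n
sumTo-last zero    _   = refl
sumTo-last (suc n) {f} f≡0 =
  trans (cong (_+ f (suc n)) (sumTo-0 n (f≡0 ∘ s≤s))) (+-identityˡ (f (suc n)))

sumTo-head : ∀ n (f : ℕ → ℚ) → sumTo (suc n) f ≡ f 0 + sumTo n (f ∘ suc)
sumTo-head zero    f = refl
sumTo-head (suc n) f = trans (cong (_+ f (suc (suc n))) (sumTo-head n f))
                             (+-assoc (f 0) (sumTo n (f ∘ suc)) (f (suc (suc n))))

sumTo-+ : ∀ n (f g : ℕ → ℚ) → sumTo n (λ i → f i + g i) ≡ sumTo n f + sumTo n g
sumTo-+ zero    f g = refl
sumTo-+ (suc n) f g = trans (cong (_+ (f (suc n) + g (suc n))) (sumTo-+ n f g))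
  (interchange (sumTo n f) (sumTo n g) (f (suc n)) (g (suc n)))
  where
  interchange : ∀ a b c d → (a + b) + (c + d) ≡ (a + c) + (b + d)
  interchange = solve-∀ ℚ-ring

sumTo-*ˡ : ∀ n c (f : ℕ → ℚ) → sumTo n (λ i → c * f i) ≡ c * sumTo n f
sumTo-*ˡ zero    c f = refl
sumTo-*ˡ (suc n) c f = trans (cong (_+ c * f (suc n)) (sumTo-*ˡ n c f)) (sym (*-distribˡ-+ c _ _))

triangleSum : ℕ → (ℕ → ℕ → ℚ) → ℚ
triangleSum n h = sumTo n (λ r → sumTo (n ∸ r) (h r))

triangleSum-cong : ∀ n {h h′ : ℕ → ℕ → ℚ} → (∀ {r s} → r ℕ.+ s ≤ n → h r s ≡ h′ r s) →
                   triangleSum n h ≡ triangleSum n h′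
triangleSum-cong n h≡h′ = sumTo-cong n λ {r} r≤n → sumTo-cong (n ∸ r) λ s≤n∸r →
  h≡h′ (ℕ.≤-trans (ℕ.+-monoʳ-≤ r s≤n∸r) (ℕ.≤-reflexive (ℕ.m+[n∸m]≡n r≤n)))

triangleSum-+ : ∀ n (h h′ : ℕ → ℕ → ℚ) →
                triangleSum n (λ r s → h r s + h′ r s) ≡ triangleSum n h + triangleSum n h′
triangleSum-+ n h h′ = trans (sumTo-cong n λ {r} _ → sumTo-+ (n ∸ r) (h r) (h′ r)) (sumTo-+ n _ _)

triangleSum-*ˡ : ∀ n c (h : ℕ → ℕ → ℚ) → triangleSum n (λ r s → c * h r s) ≡ c * triangleSum n h
triangleSum-*ˡ n c h = trans (sumTo-cong n λ {r} _ → sumTo-*ˡ (n ∸ r) c (h r)) (sumTo-*ˡ n c _)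

triangleSum-column : ∀ n (h : ℕ → ℕ → ℚ) →
  triangleSum (suc n) h ≡ sumTo (suc n) (λ r → h r 0) + triangleSum n (λ r s → h r (suc s))
triangleSum-column n h = begin
  sumTo n (λ r → sumTo (suc n ∸ r) (h r)) + sumTo (n ∸ n) (h (suc n))
    ≡⟨ cong₂ _+_ (trans (sumTo-cong n splitRow) (sumTo-+ n _ _)) lastRow ⟩
  (sumTo n (λ r → h r 0) + triangleSum n (λ r s → h r (suc s))) + h (suc n) 0
    ≡⟨ swap (sumTo n (λ r → h r 0)) (triangleSum n (λ r s → h r (suc s))) (h (suc n) 0) ⟩
  sumTo (suc n) (λ r → h r 0) + triangleSum n (λ r s → h r (suc s)) ∎
  where
  splitRow : ∀ {r} → r ≤ n → sumTo (suc n ∸ r) (h r) ≡ h r 0 + sumTo (n ∸ r) (h r ∘ suc)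
  splitRow {r} r≤n rewrite ℕ.+-∸-assoc 1 r≤n = sumTo-head (n ∸ r) (h r)
  lastRow : sumTo (n ∸ n) (h (suc n)) ≡ h (suc n) 0
  lastRow rewrite ℕ.n∸n≡0 n = refl
  swap : ∀ a b c → (a + b) + c ≡ (a + c) + b
  swap = solve-∀ ℚ-ring

triangleSum-diagonal : ∀ n (h : ℕ → ℕ → ℚ) →
  triangleSum (suc n) h ≡ triangleSum n h + sumTo (suc n) (λ r → h r (suc n ∸ r))
triangleSum-diagonal n h = begin
  sumTo n (λ r → sumTo (suc n ∸ r) (h r)) + sumTo (n ∸ n) (h (suc n))
    ≡⟨ cong₂ _+_ (trans (sumTo-cong n splitRow) (sumTo-+ n _ _)) lastRow ⟩
  (triangleSum n h + sumTo n (λ r → h r (suc n ∸ r))) + h (suc n) (n ∸ n)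
    ≡⟨ +-assoc (triangleSum n h) (sumTo n (λ r → h r (suc n ∸ r))) (h (suc n) (n ∸ n)) ⟩
  triangleSum n h + sumTo (suc n) (λ r → h r (suc n ∸ r)) ∎
  where
  splitRow : ∀ {r} → r ≤ n → sumTo (suc n ∸ r) (h r) ≡ sumTo (n ∸ r) (h r) + h r (suc n ∸ r)
  splitRow {r} r≤n rewrite ℕ.+-∸-assoc 1 r≤n = refl
  lastRow : sumTo (n ∸ n) (h (suc n)) ≡ h (suc n) (n ∸ n)
  lastRow rewrite ℕ.n∸n≡0 n = refl

-- Power sums and second-order recurrences

powerSum-rec : ∀ e f n → (e ^ℚ suc (suc n) + f ^ℚ suc (suc n)) + (e * f) * (e ^ℚ n + f ^ℚ n)
                         ≡ (e + f) * (e ^ℚ suc n + f ^ℚ suc n)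
powerSum-rec e f n = identity e f (e ^ℚ n) (f ^ℚ n)
  where
  identity : ∀ e f a b → (e * (e * a) + f * (f * b)) + (e * f) * (a + b)
                         ≡ (e + f) * (e * a + f * b)
  identity = solve-∀ ℚ-ring

second-order-recurrence-unique : ∀ (s t : ℚ) {u v : ℕ → ℚ} →
  (∀ n → u (suc (suc n)) + t * u n ≡ s * u (suc n)) →
  (∀ n → v (suc (suc n)) + t * v n ≡ s * v (suc n)) →
  u 0 ≡ v 0 → u 1 ≡ v 1 → ∀ n → u n ≡ v n
second-order-recurrence-unique s t {u} {v} u-rec v-rec u₀≡v₀ u₁≡v₁ n = proj₁ (agree n)
  where
  agree : ∀ n → u n ≡ v n × u (suc n) ≡ v (suc n)
  agree zero = u₀≡v₀ , u₁≡v₁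
  agree (suc n) with agree n
  ... | uₙ≡vₙ , uₙ₊₁≡vₙ₊₁ = uₙ₊₁≡vₙ₊₁ , ∙-cancelʳ (t * v n) (u (suc (suc n))) (v (suc (suc n))) (begin
    u (suc (suc n)) + t * v n  ≡⟨ cong (λ w → u (suc (suc n)) + t * w) uₙ≡vₙ ⟨
    u (suc (suc n)) + t * u n  ≡⟨ u-rec n ⟩
    s * u (suc n)              ≡⟨ cong (s *_) uₙ₊₁≡vₙ₊₁ ⟩
    s * v (suc n)              ≡⟨ v-rec n ⟨
    v (suc (suc n)) + t * v n  ∎)

shift : (ℕ → ℚ) → ℕ → ℚ
shift u zero    = 0ℚ
shift u (suc r) = u r

binom : ℕ → ℕ → ℚ
binom zero    r       = 1ℚ
binom (suc j) zero    = 1ℚ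
binom (suc j) (suc r) = binom j (suc r) + binom (suc j) r

binom-zeroʳ : ∀ j → binom j 0 ≡ 1ℚ
binom-zeroʳ zero    = refl
binom-zeroʳ (suc j) = refl

binom-pascal : ∀ j r → binom (suc j) r ≡ binom j r + shift (binom (suc j)) r
binom-pascal j zero    = sym (trans (+-identityʳ (binom j 0)) (binom-zeroʳ j))
binom-pascal j (suc r) = refl

fromℕ-C≡binom : ∀ j r → fromℕ ((j ℕ.+ r) C r) ≡ binom j r
fromℕ-C≡binom zero    r       = cong fromℕ (nCn≡1 r)
fromℕ-C≡binom (suc j) zero    = refl
fromℕ-C≡binom (suc j) (suc r) = begin
  fromℕ (suc n C suc r)
    ≡⟨ cong fromℕ (nCk+nC[k+1]≡[n+1]C[k+1] n r) ⟨
  fromℕ (n C r ℕ.+ n C suc r)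
    ≡⟨ fromℕ-+ (n C r) (n C suc r) ⟩
  fromℕ (n C r) + fromℕ (n C suc r)
    ≡⟨ cong₂ _+_ (trans (cong (λ m → fromℕ (m C r)) (ℕ.+-suc j r)) (fromℕ-C≡binom (suc j) r))
                 (fromℕ-C≡binom j (suc r)) ⟩
  binom (suc j) r + binom j (suc r)
    ≡⟨ +-comm (binom (suc j) r) (binom j (suc r)) ⟩
  binom (suc j) (suc r) ∎
  where
  n : ℕ
  n = j ℕ.+ suc r

binom-oneʳ : ∀ j → binom j 1 ≡ fromℕ (suc j)
binom-oneʳ zero    = refl
binom-oneʳ (suc j) =
  trans (cong (_+ 1ℚ) (binom-oneʳ j)) (trans (+-comm (fromℕ (suc j)) 1ℚ) (sym (fromℕ-+ 1 (suc j))))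

binom-oneˡ : ∀ r → binom 1 r ≡ fromℕ (suc r)
binom-oneˡ zero    = refl
binom-oneˡ (suc r) = trans (cong (_+_ 1ℚ) (binom-oneˡ r)) (sym (fromℕ-+ 1 (suc r)))

binom-absorb : ∀ j r → fromℕ (suc j) * binom (suc j) r ≡ fromℕ (suc r) * binom j (suc r)
binom-absorb j       zero    =
  trans (*-identityʳ (fromℕ (suc j))) (trans (sym (binom-oneʳ j)) (sym (*-identityˡ (binom j 1))))
binom-absorb zero    (suc t) =
  trans (*-identityˡ (binom 1 (suc t))) (trans (binom-oneˡ (suc t)) (sym (*-identityʳ (fromℕ (suc (suc t))))))
binom-absorb (suc i) (suc t) = begin
  fromℕ (2+ i) * (X + binom (2+ i) t)
    ≡⟨ *-distribˡ-+ (fromℕ (2+ i)) X (binom (2+ i) t) ⟩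
  fromℕ (2+ i) * X + fromℕ (2+ i) * binom (2+ i) t
    ≡⟨ cong (_+_ (fromℕ (2+ i) * X)) (binom-absorb (suc i) t) ⟩
  fromℕ (2+ i) * X + fromℕ (suc t) * X
    ≡⟨ *-distribʳ-+ X (fromℕ (2+ i)) (fromℕ (suc t)) ⟨
  (fromℕ (2+ i) + fromℕ (suc t)) * X
    ≡⟨ cong (_* X) shuffle ⟩
  (fromℕ (suc i) + fromℕ (2+ t)) * X
    ≡⟨ *-distribʳ-+ X (fromℕ (suc i)) (fromℕ (2+ t)) ⟩
  fromℕ (suc i) * X + fromℕ (2+ t) * X
    ≡⟨ cong (_+ fromℕ (2+ t) * X) (binom-absorb i (suc t)) ⟩
  fromℕ (2+ t) * binom i (2+ t) + fromℕ (2+ t) * X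
    ≡⟨ *-distribˡ-+ (fromℕ (2+ t)) (binom i (2+ t)) X ⟨
  fromℕ (2+ t) * (binom i (2+ t) + X) ∎
  where
  2+ : ℕ → ℕ
  2+ n = suc (suc n)
  X : ℚ
  X = binom (suc i) (suc t)
  shuffle : fromℕ (2+ i) + fromℕ (suc t) ≡ fromℕ (suc i) + fromℕ (2+ t)
  shuffle = begin
    fromℕ (2+ i) + fromℕ (suc t)      ≡⟨ fromℕ-+ (2+ i) (suc t) ⟨
    fromℕ (2+ i ℕ.+ suc t)            ≡⟨ cong (fromℕ ∘ suc) (ℕ.+-suc i (suc t)) ⟨
    fromℕ (suc i ℕ.+ 2+ t)            ≡⟨ fromℕ-+ (suc i) (2+ t) ⟩
    fromℕ (suc i) + fromℕ (2+ t)      ∎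

shift-binom-absorb : ∀ j r → fromℕ (suc j) * shift (binom (suc j)) r ≡ fromℕ r * binom j r
shift-binom-absorb j zero    = trans (*-zeroʳ (fromℕ (suc j))) (sym (*-zeroˡ (binom j 0)))
shift-binom-absorb j (suc r) = binom-absorb j r

-- Coefficients of the power sums

shift₁ : (ℕ → ℕ → ℚ) → ℕ → ℕ → ℚ
shift₁ f r s = shift (λ r′ → f r′ s) r

shift₂ : (ℕ → ℕ → ℚ) → ℕ → ℕ → ℚ
shift₂ f r = shift (f r)

-- γ K r s is the coefficient of P^r Q^s in (1 - P Q) / ((1 - P) (1 - Q))^(K + 1).
γ : ℕ → ℕ → ℕ → ℚ
γ K r s = binom K r * binom K s - shift (binom K) r * shift (binom K) s

γ-rec : ∀ j r s → γ (suc j) r s + shift₁ (shift₂ (γ (suc j))) r s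
                  ≡ γ j r s + shift₁ (γ (suc j)) r s + shift₂ (γ (suc j)) r s
γ-rec j zero    zero    rewrite binom-zeroʳ j = refl
γ-rec j (suc r) zero    rewrite binom-zeroʳ j =
  edge (binom j (suc r)) (binom (suc j) r) (binom j r) (shift (binom (suc j)) r)
  where
  edge : ∀ a b c d → (a + b) * 1ℚ - b * 0ℚ + 0ℚ ≡ a * 1ℚ - c * 0ℚ + (b * 1ℚ - d * 0ℚ) + 0ℚ
  edge = solve-∀ ℚ-ring
γ-rec j zero    (suc s) rewrite binom-zeroʳ j =
  edge (binom j (suc s)) (binom (suc j) s) (binom j s) (shift (binom (suc j)) s)
  where
  edge : ∀ a b c d → 1ℚ * (a + b) - 0ℚ * b + 0ℚ ≡ 1ℚ * a - 0ℚ * c + 0ℚ + (1ℚ * b - 0ℚ * d)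
  edge = solve-∀ ℚ-ring
γ-rec j (suc r) (suc s) = begin
  lhs (binom (suc j) r) (binom (suc j) s)
    ≡⟨ cong₂ lhs (binom-pascal j r) (binom-pascal j s) ⟩
  lhs (vr + zr) (vs + zs)
    ≡⟨ interior a b vr zr vs zs ⟩
  rhs (vr + zr) (vs + zs)
    ≡⟨ cong₂ rhs (binom-pascal j r) (binom-pascal j s) ⟨
  rhs (binom (suc j) r) (binom (suc j) s) ∎
  where
  a b vr vs zr zs : ℚ
  a  = binom j (suc r)
  b  = binom j (suc s)
  vr = binom j r
  vs = binom j s
  zr = shift (binom (suc j)) r
  zs = shift (binom (suc j)) s
  lhs rhs : ℚ → ℚ → ℚ
  lhs u v = ((a + u) * (b + v) - u * v) + (u * v - zr * zs)
  rhs u v = (a * b - vr * vs) + (u * (b + v) - zr * v) + ((a + u) * v - u * zs)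
  interior : ∀ a b vr zr vs zs →
    ((a + (vr + zr)) * (b + (vs + zs)) - (vr + zr) * (vs + zs)) + ((vr + zr) * (vs + zs) - zr * zs)
    ≡ (a * b - vr * vs) + ((vr + zr) * (b + (vs + zs)) - zr * (vs + zs))
      + ((a + (vr + zr)) * (vs + zs) - (vr + zr) * zs)
  interior = solve-∀ ℚ-ring

γ-closed-form : ∀ j r s → (+ suc (j ℕ.+ (r ℕ.+ s)) / suc j) * binom j s * binom j r ≡ γ (suc j) r s
γ-closed-form j r s = *-cancelʳ-≡ _ _ k (begin
  w * bs * br * k
    ≡⟨ regroup w bs br k ⟩
  (w * k) * (bs * br)
    ≡⟨ cong (_* (bs * br)) (n/[1+k]*[1+k]≡n (suc j ℕ.+ (r ℕ.+ s)) j) ⟩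
  fromℕ (suc j ℕ.+ (r ℕ.+ s)) * (bs * br)
    ≡⟨ cong (_* (bs * br)) (trans (fromℕ-+ (suc j) (r ℕ.+ s)) (cong (_+_ k) (fromℕ-+ r s))) ⟩
  (k + (fromℕ r + fromℕ s)) * (bs * br)
    ≡⟨ expand k (fromℕ r) (fromℕ s) br bs ⟩
  k * (br * bs) + (fromℕ r * br) * bs + br * (fromℕ s * bs)
    ≡⟨ cong₂ (λ u v → k * (br * bs) + u * bs + br * v)
             (shift-binom-absorb j r) (shift-binom-absorb j s) ⟨
  k * (br * bs) + (k * zr) * bs + br * (k * zs)
    ≡⟨ collect k br zr bs zs ⟩
  ((br + zr) * (bs + zs) - zr * zs) * k
    ≡⟨ cong₂ (λ u v → (u * v - zr * zs) * k) (binom-pascal j r) (binom-pascal j s) ⟨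
  γ (suc j) r s * k ∎)
  where
  k w br bs zr zs : ℚ
  k  = fromℕ (suc j)
  w  = + suc (j ℕ.+ (r ℕ.+ s)) / suc j
  br = binom j r
  bs = binom j s
  zr = shift (binom (suc j)) r
  zs = shift (binom (suc j)) s
  regroup : ∀ w a b k → w * a * b * k ≡ (w * k) * (a * b)
  regroup = solve-∀ ℚ-ring
  expand : ∀ k r s a b → (k + (r + s)) * (b * a) ≡ k * (a * b) + (r * a) * b + a * (s * b)
  expand = solve-∀ ℚ-ring
  collect : ∀ k a z b y → k * (a * b) + (k * z) * b + a * (k * y)
                          ≡ ((a + z) * (b + y) - z * y) * k
  collect = solve-∀ ℚ-ring

-- top r s is the coefficient of P^r Q^s in P^(r + s) + Q^(r + s).
top : ℕ → ℕ → ℚ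
top zero    zero    = 1ℚ + 1ℚ
top zero    (suc s) = 1ℚ
top (suc r) zero    = 1ℚ
top (suc r) (suc s) = 0ℚ

top≡γ₀ : ∀ r s → 1 ≤ r ℕ.+ s → top r s ≡ γ 0 r s
top≡γ₀ zero    (suc s) _ = refl
top≡γ₀ (suc r) zero    _ = refl
top≡γ₀ (suc r) (suc s) _ = refl

top-rec : ∀ r s → 2 ≤ r ℕ.+ s →
          top r s + shift₁ (shift₂ top) r s ≡ 0ℚ + shift₁ top r s + shift₂ top r s
top-rec zero          (suc zero)    (s≤s ())
top-rec (suc zero)    zero          (s≤s ())
top-rec zero          (suc (suc s)) _ = refl
top-rec (suc zero)    (suc zero)    _ = refl
top-rec (suc zero)    (suc (suc s)) _ = refl
top-rec (suc (suc r)) zero          _ = refl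
top-rec (suc (suc r)) (suc zero)    _ = refl
top-rec (suc (suc r)) (suc (suc s)) _ = refl

layer : ℕ → ℕ → ℕ → ℚ
layer zero          r s = 0ℚ
layer (suc zero)        = top
layer (suc (suc K))     = γ (suc K)

-- layer (suc K) r s is a coefficient of E^N + F^N for N = K + r + s, and the recurrence
-- expressing E^N + F^N through the two previous power sums starts at N = 2.
layer-rec : ∀ K r s → 2 ≤ K ℕ.+ (r ℕ.+ s) →
            layer (suc K) r s + shift₁ (shift₂ (layer (suc K))) r s
            ≡ layer K r s + shift₁ (layer (suc K)) r s + shift₂ (layer (suc K)) r s
layer-rec zero          r s 2≤r+s = top-rec r s 2≤r+s
layer-rec (suc zero)    r s 2≤1+r+s =
  trans (γ-rec 0 r s)
        (cong (λ t → t + shift₁ (γ 1) r s + shift₂ (γ 1) r s) (sym (top≡γ₀ r s (ℕ.≤-pred 2≤1+r+s))))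
layer-rec (suc (suc K)) r s _ = γ-rec (suc K) r s

-- powerSumCoeff N r s is the coefficient of P^r Q^s in E^N + F^N, indexed through layer by
-- N + 1 - (r + s): layer 0 covers the degrees above N and layer 1 the top degree N.
powerSumCoeff : ℕ → ℕ → ℕ → ℚ
powerSumCoeff N r s = layer (suc N ∸ (r ℕ.+ s)) r s

powerSumCoeff-above : ∀ {N r s} → N < r ℕ.+ s → powerSumCoeff N r s ≡ 0ℚ
powerSumCoeff-above {r = r} {s} N<r+s = cong (λ K → layer K r s) (ℕ.m≤n⇒m∸n≡0 N<r+s)

powerSumCoeff-top : ∀ {N r} → r ≤ N → powerSumCoeff N r (N ∸ r) ≡ top r (N ∸ r)
powerSumCoeff-top {N} {r} r≤N =
  subst (λ M → layer (suc M ∸ (r ℕ.+ (N ∸ r))) r (N ∸ r) ≡ top r (N ∸ r)) (ℕ.m+[n∸m]≡n r≤N)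
        (cong (λ K → layer K r (N ∸ r)) (ℕ.m+n∸n≡m 1 (r ℕ.+ (N ∸ r))))

powerSumCoeff-below : ∀ K r s → powerSumCoeff (suc (K ℕ.+ (r ℕ.+ s))) r s ≡ γ (suc K) r s
powerSumCoeff-below K r s = cong (λ e → layer e r s) (ℕ.m+n∸n≡m (suc (suc K)) (r ℕ.+ s))

shift₂-powerSumCoeff : ∀ N r s →
                       shift₂ (powerSumCoeff N) r s ≡ shift₂ (layer (suc (suc N) ∸ (r ℕ.+ s))) r s
shift₂-powerSumCoeff N r zero    = refl
shift₂-powerSumCoeff N r (suc s) = cong (λ n → layer (suc (suc N) ∸ n) r s) (sym (ℕ.+-suc r s))

shift₁-powerSumCoeff : ∀ N r s →
                       shift₁ (powerSumCoeff N) r s ≡ shift₁ (layer (suc (suc N) ∸ (r ℕ.+ s))) r s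
shift₁-powerSumCoeff N zero    s = refl
shift₁-powerSumCoeff N (suc r) s = refl

shift₁₂-powerSumCoeff : ∀ N r s → shift₁ (shift₂ (powerSumCoeff N)) r s
                                  ≡ shift₁ (shift₂ (layer (suc (suc (suc N)) ∸ (r ℕ.+ s)))) r s
shift₁₂-powerSumCoeff N zero    s = refl
shift₁₂-powerSumCoeff N (suc r) s = shift₂-powerSumCoeff N r s

m∸n≡1+k⇒m≤1+k+n : ∀ {m n k} → m ∸ n ≡ suc k → m ≤ suc (k ℕ.+ n)
m∸n≡1+k⇒m≤1+k+n {m} {n} {k} m∸n≡1+k =
  subst (m ≤_) (trans (cong (n ℕ.+_) m∸n≡1+k) (trans (ℕ.+-suc n k) (cong suc (ℕ.+-comm n k))))
        (ℕ.m≤n+m∸n m n)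

layer-rec-excess : ∀ N r s → let K = suc (suc (suc N)) ∸ (r ℕ.+ s) in
                   layer K r s + shift₁ (shift₂ (layer K)) r s
                   ≡ layer (ℕ.pred K) r s + shift₁ (layer K) r s + shift₂ (layer K) r s
layer-rec-excess N r s with suc (suc (suc N)) ∸ (r ℕ.+ s) in eq
... | zero  = layer₀-rec r s
  where
  layer₀-rec : ∀ r s → 0ℚ + shift₁ (shift₂ (layer 0)) r s ≡ 0ℚ + shift₁ (layer 0) r s + shift₂ (layer 0) r s
  layer₀-rec zero    zero    = refl
  layer₀-rec zero    (suc s) = refl
  layer₀-rec (suc r) zero    = refl
  layer₀-rec (suc r) (suc s) = refl
... | suc K = layer-rec K r s (ℕ.≤-trans (s≤s (s≤s z≤n)) (ℕ.≤-pred (m∸n≡1+k⇒m≤1+k+n eq)))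

powerSumCoeff-rec : ∀ N r s →
  powerSumCoeff (suc (suc N)) r s + shift₁ (shift₂ (powerSumCoeff N)) r s
  ≡ powerSumCoeff (suc N) r s + shift₁ (powerSumCoeff (suc N)) r s + shift₂ (powerSumCoeff (suc N)) r s
powerSumCoeff-rec N r s = begin
  layer K r s + shift₁ (shift₂ (powerSumCoeff N)) r s
    ≡⟨ cong (_+_ (layer K r s)) (shift₁₂-powerSumCoeff N r s) ⟩
  layer K r s + shift₁ (shift₂ (layer K)) r s
    ≡⟨ layer-rec-excess N r s ⟩
  layer (ℕ.pred K) r s + shift₁ (layer K) r s + shift₂ (layer K) r s
    ≡⟨ cong₂ _+_ (cong₂ _+_ (cong (λ K′ → layer K′ r s) pred-K)
                            (sym (shift₁-powerSumCoeff (suc N) r s)))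
                 (sym (shift₂-powerSumCoeff (suc N) r s)) ⟩
  powerSumCoeff (suc N) r s + shift₁ (powerSumCoeff (suc N)) r s + shift₂ (powerSumCoeff (suc N)) r s ∎
  where
  K : ℕ
  K = suc (suc (suc N)) ∸ (r ℕ.+ s)
  pred-K : ℕ.pred K ≡ suc (suc N) ∸ (r ℕ.+ s)
  pred-K = ℕ.pred[m∸n]≡m∸[1+n] (suc (suc (suc N))) (r ℕ.+ s)

explicitCoeff : ℕ → ℕ → ℕ → ℚ
explicitCoeff m r s =
  ((+ suc m) / suc (m ∸ r ∸ s)) * ((+ ((m ∸ r) C s)) / 1) * ((+ ((m ∸ s) C r)) / 1)

explicitCoeff≡γ : ∀ K r s → explicitCoeff (K ℕ.+ (r ℕ.+ s)) r s ≡ γ (suc K) r s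
explicitCoeff≡γ K r s = begin
  explicitCoeff m r s
    ≡⟨ cong₂ _*_ (cong₂ _*_ (cong (λ d → + suc m / suc d) m∸r∸s≡K)
                            (cong (λ n → + (n C s) / 1) m∸r≡K+s))
                 (cong (λ n → + (n C r) / 1) m∸s≡K+r) ⟩
  w * (+ ((K ℕ.+ s) C s) / 1) * (+ ((K ℕ.+ r) C r) / 1)
    ≡⟨ cong₂ (λ u v → w * u * v) (trans (n/1≡fromℕ _) (fromℕ-C≡binom K s))
                                  (trans (n/1≡fromℕ _) (fromℕ-C≡binom K r)) ⟩
  w * binom K s * binom K r
    ≡⟨ γ-closed-form K r s ⟩
  γ (suc K) r s ∎
  where
  m : ℕ
  m = K ℕ.+ (r ℕ.+ s)
  w : ℚ
  w = + suc m / suc K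
  m∸r∸s≡K : m ∸ r ∸ s ≡ K
  m∸r∸s≡K = trans (ℕ.∸-+-assoc m r s) (ℕ.m+n∸n≡m K (r ℕ.+ s))
  m∸r≡K+s : m ∸ r ≡ K ℕ.+ s
  m∸r≡K+s = trans (cong (_∸ r) (trans (cong (K ℕ.+_) (ℕ.+-comm r s)) (sym (ℕ.+-assoc K s r))))
                  (ℕ.m+n∸n≡m (K ℕ.+ s) r)
  m∸s≡K+r : m ∸ s ≡ K ℕ.+ r
  m∸s≡K+r = trans (cong (_∸ s) (sym (ℕ.+-assoc K r s))) (ℕ.m+n∸n≡m (K ℕ.+ r) s)

explicitCoeff≡powerSumCoeff : ∀ {m r s} → r ℕ.+ s ≤ m →
                              explicitCoeff m r s ≡ powerSumCoeff (suc m) r s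
explicitCoeff≡powerSumCoeff {m} {r} {s} r+s≤m =
  subst (λ m → explicitCoeff m r s ≡ powerSumCoeff (suc m) r s)
        (trans (ℕ.+-comm K (r ℕ.+ s)) (ℕ.m+[n∸m]≡n r+s≤m))
        (trans (explicitCoeff≡γ K r s) (sym (powerSumCoeff-below K r s)))
  where
  K : ℕ
  K = m ∸ (r ℕ.+ s)

-- Evaluation at P and Q

module Evaluation (p q : ℚ) where

  eval : ℕ → (ℕ → ℕ → ℚ) → ℚ
  eval n f = triangleSum n (λ r s → f r s * (p ^ℚ r * q ^ℚ s))

  eval-cong : ∀ n {f g : ℕ → ℕ → ℚ} → (∀ r s → f r s ≡ g r s) → eval n f ≡ eval n g
  eval-cong n f≡g = triangleSum-cong n λ {r} {s} _ → cong (_* (p ^ℚ r * q ^ℚ s)) (f≡g r s)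

  eval-+ : ∀ n (f g : ℕ → ℕ → ℚ) → eval n (λ r s → f r s + g r s) ≡ eval n f + eval n g
  eval-+ n f g =
    trans (triangleSum-cong n λ {r} {s} _ → *-distribʳ-+ (p ^ℚ r * q ^ℚ s) (f r s) (g r s))
          (triangleSum-+ n _ _)

  eval-shift₁ : ∀ n f → eval (suc n) (shift₁ f) ≡ p * eval n f
  eval-shift₁ n f = begin
    eval (suc n) (shift₁ f)
      ≡⟨ sumTo-head n _ ⟩
    sumTo (suc n) (λ s → 0ℚ * (1ℚ * q ^ℚ s))
      + triangleSum n (λ r s → f r s * (p ^ℚ suc r * q ^ℚ s))
      ≡⟨ cong₂ _+_ (sumTo-0 (suc n) λ {s} _ → *-zeroˡ (1ℚ * q ^ℚ s))
                   (triangleSum-cong n λ {r} {s} _ → pull p (f r s) (p ^ℚ r) (q ^ℚ s)) ⟩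
    0ℚ + triangleSum n (λ r s → p * (f r s * (p ^ℚ r * q ^ℚ s)))
      ≡⟨ +-identityˡ _ ⟩
    triangleSum n (λ r s → p * (f r s * (p ^ℚ r * q ^ℚ s)))
      ≡⟨ triangleSum-*ˡ n p _ ⟩
    p * eval n f ∎
    where
    pull : ∀ p c a b → c * (p * a * b) ≡ p * (c * (a * b))
    pull = solve-∀ ℚ-ring

  eval-shift₂ : ∀ n f → eval (suc n) (shift₂ f) ≡ q * eval n f
  eval-shift₂ n f = begin
    eval (suc n) (shift₂ f)
      ≡⟨ triangleSum-column n _ ⟩
    sumTo (suc n) (λ r → 0ℚ * (p ^ℚ r * 1ℚ))
      + triangleSum n (λ r s → f r s * (p ^ℚ r * q ^ℚ suc s))
      ≡⟨ cong₂ _+_ (sumTo-0 (suc n) λ {r} _ → *-zeroˡ (p ^ℚ r * 1ℚ))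
                   (triangleSum-cong n λ {r} {s} _ → pull q (f r s) (p ^ℚ r) (q ^ℚ s)) ⟩
    0ℚ + triangleSum n (λ r s → q * (f r s * (p ^ℚ r * q ^ℚ s)))
      ≡⟨ +-identityˡ _ ⟩
    triangleSum n (λ r s → q * (f r s * (p ^ℚ r * q ^ℚ s)))
      ≡⟨ triangleSum-*ˡ n q _ ⟩
    q * eval n f ∎
    where
    pull : ∀ q c a b → c * (a * (q * b)) ≡ q * (c * (a * b))
    pull = solve-∀ ℚ-ring

  eval-suc-vanishing : ∀ n {f} → (∀ {r s} → n < r ℕ.+ s → f r s ≡ 0ℚ) →
                       eval (suc n) f ≡ eval n f
  eval-suc-vanishing n {f} f≡0 = begin
    eval (suc n) f
      ≡⟨ triangleSum-diagonal n _ ⟩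
    eval n f + sumTo (suc n) (λ r → f r (suc n ∸ r) * (p ^ℚ r * q ^ℚ (suc n ∸ r)))
      ≡⟨ cong (_+_ (eval n f)) (sumTo-0 (suc n) λ {r} r≤1+n →
           trans (cong (_* _) (f≡0 (ℕ.≤-reflexive (sym (ℕ.m+[n∸m]≡n r≤1+n)))))
                 (*-zeroˡ (p ^ℚ r * q ^ℚ (suc n ∸ r)))) ⟩
    eval n f + 0ℚ
      ≡⟨ +-identityʳ (eval n f) ⟩
    eval n f ∎

  eval-powerSumCoeff-rec : ∀ N →
    eval (suc (suc N)) (powerSumCoeff (suc (suc N))) + (p * q) * eval N (powerSumCoeff N)
    ≡ (1ℚ + p + q) * eval (suc N) (powerSumCoeff (suc N))
  eval-powerSumCoeff-rec N = begin
    eval N₂ (c N₂) + (p * q) * eval N (c N)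
      ≡⟨ cong (_+_ (eval N₂ (c N₂))) (trans (*-assoc p q (eval N (c N)))
           (sym (trans (eval-shift₁ N₁ (shift₂ (c N))) (cong (p *_) (eval-shift₂ N (c N)))))) ⟩
    eval N₂ (c N₂) + eval N₂ (shift₁ (shift₂ (c N)))
      ≡⟨ eval-+ N₂ (c N₂) (shift₁ (shift₂ (c N))) ⟨
    eval N₂ (λ r s → c N₂ r s + shift₁ (shift₂ (c N)) r s)
      ≡⟨ eval-cong N₂ (powerSumCoeff-rec N) ⟩
    eval N₂ (λ r s → c N₁ r s + shift₁ (c N₁) r s + shift₂ (c N₁) r s)
      ≡⟨ trans (eval-+ N₂ (λ r s → c N₁ r s + shift₁ (c N₁) r s) (shift₂ (c N₁)))
               (cong (_+ eval N₂ (shift₂ (c N₁))) (eval-+ N₂ (c N₁) (shift₁ (c N₁)))) ⟩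
    eval N₂ (c N₁) + eval N₂ (shift₁ (c N₁)) + eval N₂ (shift₂ (c N₁))
      ≡⟨ cong₂ _+_ (cong₂ _+_ (eval-suc-vanishing N₁ λ {r} {s} → powerSumCoeff-above {N₁} {r} {s})
                              (eval-shift₁ N₁ (c N₁)))
                   (eval-shift₂ N₁ (c N₁)) ⟩
    G + p * G + q * G
      ≡⟨ factor p q G ⟩
    (1ℚ + p + q) * G ∎
    where
    c : ℕ → ℕ → ℕ → ℚ
    c = powerSumCoeff
    N₁ N₂ : ℕ
    N₁ = suc N
    N₂ = suc N₁
    G : ℚ
    G = eval N₁ (c N₁)
    factor : ∀ p q g → g + p * g + q * g ≡ (1ℚ + p + q) * g
    factor = solve-∀ ℚ-ring

  eval-powerSumCoeff-one : eval 1 (powerSumCoeff 1) ≡ 1ℚ + p + q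
  eval-powerSumCoeff-one = expand p q
    where
    expand : ∀ p q → (1ℚ * 1ℚ - 0ℚ * 0ℚ) * (1ℚ * 1ℚ) + 1ℚ * (1ℚ * (q * 1ℚ)) + 1ℚ * (p * 1ℚ * 1ℚ)
                     ≡ 1ℚ + p + q
    expand = solve-∀ ℚ-ring

  powerSum≡eval : ∀ e f → e + f ≡ 1ℚ + p + q → e * f ≡ p * q →
                  ∀ N → e ^ℚ N + f ^ℚ N ≡ eval N (powerSumCoeff N)
  powerSum≡eval e f e+f e*f = second-order-recurrence-unique (1ℚ + p + q) (p * q)
    (λ n → subst₂ (λ s t → e ^ℚ suc (suc n) + f ^ℚ suc (suc n) + t * (e ^ℚ n + f ^ℚ n)
                           ≡ s * (e ^ℚ suc n + f ^ℚ suc n))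
                  e+f e*f (powerSum-rec e f n))
    eval-powerSumCoeff-rec
    refl
    (trans (cong₂ _+_ (*-identityʳ e) (*-identityʳ f)) (trans e+f (sym eval-powerSumCoeff-one)))

  top-diagonal : ∀ m → sumTo (suc m) (λ r → top r (suc m ∸ r) * (p ^ℚ r * q ^ℚ (suc m ∸ r)))
                       ≡ q ^ℚ suc m + p ^ℚ suc m
  top-diagonal m = begin
    sumTo (suc m) (λ r → top r (suc m ∸ r) * (p ^ℚ r * q ^ℚ (suc m ∸ r)))
      ≡⟨ sumTo-head m _ ⟩
    1ℚ * (1ℚ * q ^ℚ suc m) + sumTo m (λ i → top (suc i) (m ∸ i) * (p ^ℚ suc i * q ^ℚ (m ∸ i)))
      ≡⟨ cong₂ _+_ (trans (*-identityˡ (1ℚ * q ^ℚ suc m)) (*-identityˡ (q ^ℚ suc m)))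
                   (sumTo-last m vanish) ⟩
    q ^ℚ suc m + top (suc m) (m ∸ m) * (p ^ℚ suc m * q ^ℚ (m ∸ m))
      ≡⟨ cong (λ k → q ^ℚ suc m + top (suc m) k * (p ^ℚ suc m * q ^ℚ k)) (ℕ.n∸n≡0 m) ⟩
    q ^ℚ suc m + 1ℚ * (p ^ℚ suc m * 1ℚ)
      ≡⟨ cong (_+_ (q ^ℚ suc m)) (trans (*-identityˡ (p ^ℚ suc m * 1ℚ)) (*-identityʳ (p ^ℚ suc m))) ⟩
    q ^ℚ suc m + p ^ℚ suc m ∎
    where
    vanish : ∀ {i} → i < m → top (suc i) (m ∸ i) * (p ^ℚ suc i * q ^ℚ (m ∸ i)) ≡ 0ℚ
    vanish {i} i<m = trans (cong (λ k → top (suc i) k * (p ^ℚ suc i * q ^ℚ k)) (ℕ.+-∸-assoc 1 i<m))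
                           (*-zeroˡ (p ^ℚ suc i * q ^ℚ suc (m ∸ suc i)))

  eval-powerSumCoeff-top : ∀ m → eval (suc m) (powerSumCoeff (suc m))
                                 ≡ (p ^ℚ suc m + q ^ℚ suc m) + eval m (powerSumCoeff (suc m))
  eval-powerSumCoeff-top m = begin
    eval (suc m) (powerSumCoeff (suc m))
      ≡⟨ triangleSum-diagonal m _ ⟩
    eval m (powerSumCoeff (suc m))
      + sumTo (suc m) (λ r → powerSumCoeff (suc m) r (suc m ∸ r) * (p ^ℚ r * q ^ℚ (suc m ∸ r)))
      ≡⟨ cong (_+_ (eval m (powerSumCoeff (suc m))))
              (trans (sumTo-cong (suc m) λ {r} r≤1+m →
                        cong (_* (p ^ℚ r * q ^ℚ (suc m ∸ r))) (powerSumCoeff-top r≤1+m))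
                     (top-diagonal m)) ⟩
    eval m (powerSumCoeff (suc m)) + (q ^ℚ suc m + p ^ℚ suc m)
      ≡⟨ +-comm (eval m (powerSumCoeff (suc m))) (q ^ℚ suc m + p ^ℚ suc m) ⟩
    (q ^ℚ suc m + p ^ℚ suc m) + eval m (powerSumCoeff (suc m))
      ≡⟨ cong (_+ eval m (powerSumCoeff (suc m))) (+-comm (q ^ℚ suc m) (p ^ℚ suc m)) ⟩
    (p ^ℚ suc m + q ^ℚ suc m) + eval m (powerSumCoeff (suc m)) ∎

-- Substituting P = x u and Q = y u

power-sums-difference : ∀ x y u N → ((1ℚ - x ^ℚ N) * (1ℚ - y ^ℚ N)) * u ^ℚ N
                                    ≡ (u ^ℚ N + ((x * y) * u) ^ℚ N) - ((x * u) ^ℚ N + (y * u) ^ℚ N)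
power-sums-difference x y u N = begin
  ((1ℚ - X) * (1ℚ - Y)) * U
    ≡⟨ expand X Y U ⟩
  (U + (X * Y) * U) - (X * U + Y * U)
    ≡⟨ cong₂ (λ a b → (U + a) - b)
             (trans (^ℚ-distrib-* (x * y) u N) (cong (_* U) (^ℚ-distrib-* x y N)))
             (cong₂ _+_ (^ℚ-distrib-* x u N) (^ℚ-distrib-* y u N)) ⟨
  (U + ((x * y) * u) ^ℚ N) - ((x * u) ^ℚ N + (y * u) ^ℚ N) ∎
  where
  X Y U : ℚ
  X = x ^ℚ N
  Y = y ^ℚ N
  U = u ^ℚ N
  expand : ∀ X Y U → ((1ℚ - X) * (1ℚ - Y)) * U ≡ (U + (X * Y) * U) - (X * U + Y * U)
  expand = solve-∀ ℚ-ring

roots-sum : ∀ x y u → u * ((1ℚ - x) * (1ℚ - y)) ≡ 1ℚ → u + (x * y) * u ≡ 1ℚ + x * u + y * u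
roots-sum x y u u[1-x][1-y]≡1 =
  trans (expand x y u) (cong (λ t → t + x * u + y * u) u[1-x][1-y]≡1)
  where
  expand : ∀ x y u → u + (x * y) * u ≡ u * ((1ℚ - x) * (1ℚ - y)) + x * u + y * u
  expand = solve-∀ ℚ-ring

roots-product : ∀ x y u → u * ((x * y) * u) ≡ (x * u) * (y * u)
roots-product = solve-∀ ℚ-ring

monomial-split : ∀ x y u r s → (x * u) ^ℚ r * (y * u) ^ℚ s ≡ (x ^ℚ r * y ^ℚ s) * u ^ℚ (r ℕ.+ s)
monomial-split x y u r s = begin
  (x * u) ^ℚ r * (y * u) ^ℚ s
    ≡⟨ cong₂ _*_ (^ℚ-distrib-* x u r) (^ℚ-distrib-* y u s) ⟩
  (x ^ℚ r * u ^ℚ r) * (y ^ℚ s * u ^ℚ s)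
    ≡⟨ regroup (x ^ℚ r) (u ^ℚ r) (y ^ℚ s) (u ^ℚ s) ⟩
  (x ^ℚ r * y ^ℚ s) * (u ^ℚ r * u ^ℚ s)
    ≡⟨ cong (_*_ (x ^ℚ r * y ^ℚ s)) (^ℚ-homo-* u r s) ⟨
  (x ^ℚ r * y ^ℚ s) * u ^ℚ (r ℕ.+ s) ∎
  where
  regroup : ∀ a b c d → (a * b) * (c * d) ≡ (a * c) * (b * d)
  regroup = solve-∀ ℚ-ring

1/p*1/q*[p*q]≡1 : ∀ p q .{{_ : NonZero p}} .{{_ : NonZero q}} → (1/ p * 1/ q) * (p * q) ≡ 1ℚ
1/p*1/q*[p*q]≡1 p q = trans (regroup (1/ p) (1/ q) p q) (cong₂ _*_ (*-inverseˡ p) (*-inverseˡ q))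
  where
  regroup : ∀ a b c d → (a * b) * (c * d) ≡ (a * c) * (b * d)
  regroup = solve-∀ ℚ-ring

explicit-term : ∀ m x y a b {r s} → r ℕ.+ s ≤ m →
  powerSumCoeff (suc m) r s * ((x * (a * b)) ^ℚ r * (y * (a * b)) ^ℚ s)
  ≡ explicitCoeff m r s * (x ^ℚ r * y ^ℚ s) * (a ^ℚ (r ℕ.+ s) * b ^ℚ (r ℕ.+ s))
explicit-term m x y a b {r} {s} r+s≤m = begin
  powerSumCoeff (suc m) r s * ((x * (a * b)) ^ℚ r * (y * (a * b)) ^ℚ s)
    ≡⟨ cong₂ _*_ (sym (explicitCoeff≡powerSumCoeff {m} {r} {s} r+s≤m))
                 (trans (monomial-split x y (a * b) r s)
                        (cong (_*_ (x ^ℚ r * y ^ℚ s)) (^ℚ-distrib-* a b (r ℕ.+ s)))) ⟩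
  explicitCoeff m r s * ((x ^ℚ r * y ^ℚ s) * (a ^ℚ (r ℕ.+ s) * b ^ℚ (r ℕ.+ s)))
    ≡⟨ *-assoc (explicitCoeff m r s) (x ^ℚ r * y ^ℚ s) (a ^ℚ (r ℕ.+ s) * b ^ℚ (r ℕ.+ s)) ⟨
  explicitCoeff m r s * (x ^ℚ r * y ^ℚ s) * (a ^ℚ (r ℕ.+ s) * b ^ℚ (r ℕ.+ s)) ∎

corollary2p6 : (m : ℕ) (x y : ℚ) → .{{_ : NonZero (1ℚ - x)}} → .{{_ : NonZero (1ℚ - y)}} →
    ((1ℚ - x ^ℚ suc m) * (1ℚ - y ^ℚ suc m)) * ((1/ (1ℚ - x)) ^ℚ suc m * (1/ (1ℚ - y)) ^ℚ suc m)
      ≡ sumTo m (λ r → sumTo (m ∸ r) (λ s →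
          ((+ suc m) / suc (m ∸ r ∸ s)) * ((+ ((m ∸ r) C s)) / 1) * ((+ ((m ∸ s) C r)) / 1)
            * (x ^ℚ r * y ^ℚ s)
            * ((1/ (1ℚ - x)) ^ℚ (r Data.Nat.+ s) * (1/ (1ℚ - y)) ^ℚ (r Data.Nat.+ s))))
corollary2p6 m x y = begin
  ((1ℚ - x ^ℚ N) * (1ℚ - y ^ℚ N)) * (a ^ℚ N * b ^ℚ N)
    ≡⟨ cong (((1ℚ - x ^ℚ N) * (1ℚ - y ^ℚ N)) *_) (^ℚ-distrib-* a b N) ⟨
  ((1ℚ - x ^ℚ N) * (1ℚ - y ^ℚ N)) * u ^ℚ N
    ≡⟨ power-sums-difference x y u N ⟩
  (u ^ℚ N + ((x * y) * u) ^ℚ N) - (P ^ℚ N + Q ^ℚ N)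
    ≡⟨ cong (_- (P ^ℚ N + Q ^ℚ N)) (trans powerSums (eval-powerSumCoeff-top m)) ⟩
  ((P ^ℚ N + Q ^ℚ N) + eval m (powerSumCoeff N)) - (P ^ℚ N + Q ^ℚ N)
    ≡⟨ cancel (P ^ℚ N + Q ^ℚ N) (eval m (powerSumCoeff N)) ⟩
  eval m (powerSumCoeff N)
    ≡⟨ triangleSum-cong m (λ {r} {s} → explicit-term m x y a b {r} {s}) ⟩
  triangleSum m (λ r s → explicitCoeff m r s * (x ^ℚ r * y ^ℚ s) * (a ^ℚ (r ℕ.+ s) * b ^ℚ (r ℕ.+ s)))
    ∎
  where
  N : ℕ
  N = suc m
  a b u P Q : ℚ
  a = 1/ (1ℚ - x)
  b = 1/ (1ℚ - y)
  u = a * b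
  P = x * u
  Q = y * u
  open Evaluation P Q
  powerSums : u ^ℚ N + ((x * y) * u) ^ℚ N ≡ eval N (powerSumCoeff N)
  powerSums = powerSum≡eval u ((x * y) * u)
                (roots-sum x y u (1/p*1/q*[p*q]≡1 (1ℚ - x) (1ℚ - y))) (roots-product x y u) N
  cancel : ∀ a b → (a + b) - a ≡ b
  cancel = solve-∀ ℚ-ring
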